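{- Let $P$ be a finite poset with $m$ minimal elements $z_1,\dots,z_m$, and let $\pi\in S_m$. The set of zigzag labelings of $P$ of type $\pi$ equals $T_P(\pi,\pi)\setminus\bigcup_{i=1}^{m-1}T_P(\pi,f_i(\pi))$, and the number of such labelings is $\sum_{S\subseteq[m-1]}(-1)^{|S|}|T_P(\pi,f_S(\pi))|$.
   Context: Let $n=|P|$. A zigzag labeling is a bijection $\phi\colon P\to[n]$ such that (1) if $x$ is minimal and $\phi(x)\ne1$ then some $y\succ x$ has $\phi(y)<\phi(x)$, and (2) if $x$ is not minimal then some minimal $y\prec x$ has $\phi(y)<\phi(x)$; it has type $\pi$ if $\phi(z_{\pi_1})>\cdots>\phi(z_{\pi_m})$. For $\sigma\in S_m$, $\theta_\sigma\colon P\to[m]$ sends $x$ to the largest $j$ with $z_{\sigma_j}\preceq x$. For $\pi,\sigma\in S_m$, $T_P(\pi,\sigma)$ is the set of bijections $\phi\colon P\to[n]$ with (1) $\phi(z_{\pi_1})>\cdots>\phi(z_{\pi_m})$ and (2) $\phi(y)\ge\phi(z_{\sigma_{\theta_\sigma(y)}})$ for all $y\in P$. For $i\in[m-1]$, $f_i(\pi)=\pi_1\cdots\widehat{\pi_i}\cdots\pi_m\pi_i$; for $S=\{s_1<\dots<s_l\}\subseteq[m-1]$, $f_S=f_{s_1}\circ\cdots\circ f_{s_l}$ (with $f_\varnothing$ the identity). -}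

module Defs where

open import Data.Nat as ℕ using (ℕ; zero; suc; pred)
open import Data.Fin as F using (Fin; toℕ; inject₁)
open import Data.Fin.Properties using (all?; any?)
import Data.Fin.Properties as FP
open import Data.Fin.Subset using (Subset; inside; outside; _∈_; ∣_∣)
open import Data.Fin.Subset.Properties using (_∈?_)
open import Data.Fin.Permutation using (Permutation′; _⟨$⟩ʳ_)
open import Data.Vec using (Vec; []; _∷_; lookup; tabulate; removeAt; _∷ʳ_)
open import Data.List using (List; []; _∷_; map; concatMap; filter; length; allFin; foldr; _++_)
open import Data.Integer as ℤ using (ℤ; +_; -_)
open import Data.Product using (Σ; ∃; _×_; _,_)
open import Relation.Nullary using (¬_; Dec; yes; no)
open import Relation.Nullary.Decidable using (_×-dec_; _→-dec_; ¬?)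
open import Relation.Unary using (Pred; Decidable)
open import Relation.Binary using (Rel; IsDecPartialOrder)
open import Relation.Binary.PropositionalEquality using (_≡_; _≢_)

record FinPoset (n : ℕ) : Set₁ where
  field
    _≼_ : Fin n → Fin n → Set
    isDecPartialOrder : IsDecPartialOrder _≡_ _≼_
  open IsDecPartialOrder isDecPartialOrder public using (_≤?_)

  _≺_ : Fin n → Fin n → Set
  x ≺ y = (x ≼ y) × (x ≢ y)

  _≺?_ : ∀ x y → Dec (x ≺ y)
  x ≺? y = (x ≤? y) ×-dec ¬? (x FP.≟ y)

  Minimal : Fin n → Set
  Minimal x = ∀ y → y ≼ x → y ≡ x

  Minimal? : ∀ x → Dec (Minimal x)
  Minimal? x = all? (λ y → (y ≤? x) →-dec (y FP.≟ x))

allVecs : ∀ k n → List (Vec (Fin n) k)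
allVecs zero    n = [] ∷ []
allVecs (suc k) n = concatMap (λ i → map (i ∷_) (allVecs k n)) (allFin n)

count : ∀ {n} {ℓ} {Q : Pred (Vec (Fin n) n) ℓ} → Decidable Q → ℕ
count {n} Q? = length (filter Q? (allVecs n n))

allSubsets : ∀ k → List (Subset k)
allSubsets zero    = [] ∷ []
allSubsets (suc k) = map (inside ∷_) (allSubsets k) ++ map (outside ∷_) (allSubsets k)

sumℤ : List ℤ → ℤ
sumℤ = foldr ℤ._+_ (+ 0)

sign : ∀ {k} → Subset k → ℤ
sign S = (- (+ 1)) ℤ.^ ∣ S ∣

-- Words (one-line notation) and the operators f_i, f_S.
-- Indices are 0-based: position i ∈ [m-1] of the paper is i : Fin (pred m).

f : ∀ {m} {A : Set} → Fin (pred m) → Vec A m → Vec A m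
f {suc k} i w = removeAt w (inject₁ i) ∷ʳ lookup w (inject₁ i)

elems : ∀ {k} → Subset k → List (Fin k)
elems S = filter (_∈? S) (allFin _)

-- f_S = f_{s₁} ∘ ⋯ ∘ f_{s_l}  with s₁ < ⋯ < s_l
fS : ∀ {m} {A : Set} → Subset (pred m) → Vec A m → Vec A m
fS S w = foldr f w (elems S)

word : ∀ {m} → Permutation′ m → Vec (Fin m) m
word π = tabulate (π ⟨$⟩ʳ_)

module Labelings {n m : ℕ} (P : FinPoset n) (z : Fin m → Fin n) where
  open FinPoset P

  -- ϕ : P → [n] given as a vector; value 0 of Fin n stands for label 1.
  IsBijection : Vec (Fin n) n → Set
  IsBijection ϕ = (∀ x y → lookup ϕ x ≡ lookup ϕ y → x ≡ y)
                × (∀ k → ∃ λ x → lookup ϕ x ≡ k)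

  IsBijection? : ∀ ϕ → Dec (IsBijection ϕ)
  IsBijection? ϕ = all? (λ x → all? (λ y → (lookup ϕ x FP.≟ lookup ϕ y) →-dec (x FP.≟ y)))
                   ×-dec all? (λ k → any? (λ x → lookup ϕ x FP.≟ k))

  HasType : Vec (Fin m) m → Vec (Fin n) n → Set
  HasType w ϕ = ∀ i j → i F.< j → lookup ϕ (z (lookup w j)) F.< lookup ϕ (z (lookup w i))

  HasType? : ∀ w ϕ → Dec (HasType w ϕ)
  HasType? w ϕ = all? (λ i → all? (λ j → (i F.<? j) →-dec
                   (lookup ϕ (z (lookup w j)) F.<? lookup ϕ (z (lookup w i)))))

  IsZigzag : Vec (Fin n) n → Set
  IsZigzag ϕ = IsBijection ϕ
             × (∀ x → Minimal x → toℕ (lookup ϕ x) ≢ 0 →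
                  ∃ λ y → x ≺ y × lookup ϕ y F.< lookup ϕ x)
             × (∀ x → ¬ Minimal x →
                  ∃ λ y → Minimal y × y ≺ x × lookup ϕ y F.< lookup ϕ x)

  IsZigzag? : ∀ ϕ → Dec (IsZigzag ϕ)
  IsZigzag? ϕ = IsBijection? ϕ
    ×-dec all? (λ x → Minimal? x →-dec (¬? (toℕ (lookup ϕ x) ℕ.≟ 0) →-dec
                 any? (λ y → (x ≺? y) ×-dec (lookup ϕ y F.<? lookup ϕ x))))
    ×-dec all? (λ x → ¬? (Minimal? x) →-dec
                 any? (λ y → Minimal? y ×-dec ((y ≺? x) ×-dec (lookup ϕ y F.<? lookup ϕ x))))

  ZigzagOfType : Vec (Fin m) m → Vec (Fin n) n → Set
  ZigzagOfType w ϕ = IsZigzag ϕ × HasType w ϕ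

  ZigzagOfType? : ∀ w ϕ → Dec (ZigzagOfType w ϕ)
  ZigzagOfType? w ϕ = IsZigzag? ϕ ×-dec HasType? w ϕ

  -- θ_σ(y) = j  iff  j is the largest index with z_{σ_j} ≼ y
  IsTheta : Vec (Fin m) m → Fin n → Fin m → Set
  IsTheta σ y j = (z (lookup σ j) ≼ y) × (∀ k → z (lookup σ k) ≼ y → k F.≤ j)

  IsTheta? : ∀ σ y j → Dec (IsTheta σ y j)
  IsTheta? σ y j = (z (lookup σ j) ≤? y) ×-dec all? (λ k → (z (lookup σ k) ≤? y) →-dec (k F.≤? j))

  T : Vec (Fin m) m → Vec (Fin m) m → Vec (Fin n) n → Set
  T π σ ϕ = IsBijection ϕ × HasType π ϕ
          × (∀ y j → IsTheta σ y j → lookup ϕ (z (lookup σ j)) F.≤ lookup ϕ y)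

  T? : ∀ π σ ϕ → Dec (T π σ ϕ)
  T? π σ ϕ = IsBijection? ϕ ×-dec HasType? π ϕ
    ×-dec all? (λ y → all? (λ j → IsTheta? σ y j →-dec (lookup ϕ (z (lookup σ j)) F.≤? lookup ϕ y)))

-- Fix a labeling ϕ of type π, so that ϕ decreases along z_{π₁}, …, z_{π_m}. For y ∈ P the
-- condition on y in T_P(π, σ) bounds ϕ(y) below by the label of the last minimal element
-- under y in the order σ; in the order π that is the smallest such label. The word f_S(π)
-- moves the entries at positions in S to the back, the earliest of them last, so the last
-- one under y becomes the earliest entry of S under y, whose label dominates all others.
-- Hence T_P(π, f_S π) is T_P(π, π) cut down by the conditions "z_{π_s} carries the smallest
-- label of its up-set", s ∈ S. On T_P(π, π) zigzag condition (2) holds automatically and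
-- z_{π_m} carries label 1, so zigzag condition (1) says exactly that none of these m - 1
-- conditions holds; inclusion–exclusion over S ⊆ [m-1] then gives the count.
module Submission where

open import Defs
open import Algebra.Bundles using (AbelianGroup)
open import Data.Empty using (⊥-elim)
open import Data.Fin as F using (Fin; zero; suc; toℕ; inject₁; lower₁)
open import Data.Fin.Induction using (po-wellFounded)
open import Data.Fin.Permutation using (Permutation′; _⟨$⟩ʳ_; _⟨$⟩ˡ_; inverseʳ)
import Data.Fin.Properties as FP
open import Data.Fin.Properties using (all?; any?; ¬∀⟶∃¬)
open import Data.Fin.Subset using (Subset; inside; outside; _∈_; ⁅_⁆; ⊥)
open import Data.Fin.Subset.Properties using (_∈?_; drop-there; x∈⁅x⁆; x∈⁅y⁆⇒x≡y)
open import Data.Integer using (ℤ; +_; -_; _+_; _*_)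
import Data.Integer.Properties as ℤP
open import Data.List using (List; []; _∷_; map; filter; foldr; length; allFin; _++_)
open import Data.List.Properties using (map-++; map-∘; map-cong; map-tabulate; filter-≐)
open import Data.Nat as ℕ using (ℕ; zero; suc; pred; _≤_; _<_; z≤n; s≤s)
import Data.Nat.Properties as ℕP
open import Data.Product using (∃; _×_; _,_; proj₁; proj₂)
open import Data.Sum using (_⊎_; inj₁; inj₂)
open import Data.Unit using (⊤; tt)
open import Data.Vec using (Vec; []; _∷_; _∷ʳ_; lookup)
open import Data.Vec.Base using (here; there)
open import Data.Vec.Properties using (lookup∘tabulate)
open import Data.Vec.Relation.Unary.All as All using (All; []; _∷_)
open import Data.Vec.Relation.Unary.All.Properties using (lookup⁺; lookup⁻)
open import Data.Vec.Relation.Unary.AllPairs using (AllPairs; []; _∷_)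
open import Function using (_∘_; id)
open import Function.Bundles using (_⇔_; mk⇔; Equivalence)
open import Function.Definitions using (Injective)
open import Induction.WellFounded using (Acc; acc)
open import Level using (0ℓ)
open import Relation.Binary using (Rel; IsDecPartialOrder)
open import Relation.Binary.PropositionalEquality
  using (_≡_; _≢_; refl; sym; trans; cong; cong₂; subst; module ≡-Reasoning)
open import Relation.Nullary using (¬_; Dec; yes; no)
open import Relation.Nullary.Decidable using (¬?; _→-dec_; decidable-stable)
open import Relation.Unary using (Pred; Decidable; _∩_; ∁; _≐_)
open import Relation.Unary.Properties using (_∩?_; ∁?)
open import Algebra.Properties.Group (AbelianGroup.group ℤP.+-0-abelianGroup) using (\\-leftDividesʳ)

open Equivalence using (to; from)

⇔⇒≐ : ∀ {X : Set} {P Q : Pred X 0ℓ} → (∀ x → P x ⇔ Q x) → P ≐ Q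
⇔⇒≐ P⇔Q = (λ {x} → to (P⇔Q x)) , (λ {x} → from (P⇔Q x))

module _ {X : Set} where

  countIn : {P : Pred X 0ℓ} → Decidable P → List X → ℕ
  countIn P? xs = length (filter P? xs)

  countIn-≐ : {P Q : Pred X 0ℓ} (P? : Decidable P) (Q? : Decidable Q) → P ≐ Q →
              ∀ xs → countIn P? xs ≡ countIn Q? xs
  countIn-≐ P? Q? P≐Q xs = cong length (filter-≐ P? Q? P≐Q xs)

  countIn-split : {P R : Pred X 0ℓ} (P? : Decidable P) (R? : Decidable R) →
                  ∀ xs → countIn P? xs ≡ countIn (P? ∩? R?) xs ℕ.+ countIn (P? ∩? ∁? R?) xs
  countIn-split P? R? [] = refl
  countIn-split P? R? (x ∷ xs) with P? x | R? x
  ... | yes _ | yes _ = cong suc (countIn-split P? R? xs)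
  ... | yes _ | no _  = trans (cong suc (countIn-split P? R? xs)) (sym (ℕP.+-suc _ _))
  ... | no _  | _     = countIn-split P? R? xs

sumℤ-++ : ∀ xs ys → sumℤ (xs ++ ys) ≡ sumℤ xs + sumℤ ys
sumℤ-++ []       ys = sym (ℤP.+-identityˡ _)
sumℤ-++ (x ∷ xs) ys = trans (cong (λ t → x + t) (sumℤ-++ xs ys)) (sym (ℤP.+-assoc x _ _))

sumℤ-map-neg : ∀ {Y : Set} (F : Y → ℤ) ys → sumℤ (map (-_ ∘ F) ys) ≡ - sumℤ (map F ys)
sumℤ-map-neg F []       = refl
sumℤ-map-neg F (y ∷ ys) = trans (cong (λ t → - F y + t) (sumℤ-map-neg F ys)) (sym (ℤP.neg-distrib-+ (F y) _))

sumℤ-allSubsets-suc : ∀ k (F : Subset (suc k) → ℤ) →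
  sumℤ (map F (allSubsets (suc k)))
    ≡ sumℤ (map (F ∘ (inside ∷_)) (allSubsets k)) + sumℤ (map (F ∘ (outside ∷_)) (allSubsets k))
sumℤ-allSubsets-suc k F = begin
  sumℤ (map F (map (inside ∷_) L ++ map (outside ∷_) L))
    ≡⟨ cong sumℤ (map-++ F (map (inside ∷_) L) _) ⟩
  sumℤ (map F (map (inside ∷_) L) ++ map F (map (outside ∷_) L))
    ≡⟨ sumℤ-++ (map F (map (inside ∷_) L)) _ ⟩
  sumℤ (map F (map (inside ∷_) L)) + sumℤ (map F (map (outside ∷_) L))
    ≡⟨ sym (cong₂ _+_ (cong sumℤ (map-∘ L)) (cong sumℤ (map-∘ L))) ⟩
  sumℤ (map (F ∘ (inside ∷_)) L) + sumℤ (map (F ∘ (outside ∷_)) L) ∎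
  where
  open ≡-Reasoning
  L : List (Subset k)
  L = allSubsets k

signed-sum : ∀ {k} → (Subset k → ℕ) → ℤ
signed-sum {k} c = sumℤ (map (λ S → sign S * + c S) (allSubsets k))

signed-sum-suc : ∀ {k} (c : Subset (suc k) → ℕ) →
                 signed-sum c ≡ - signed-sum (c ∘ (inside ∷_)) + signed-sum (c ∘ (outside ∷_))
signed-sum-suc {k} c = trans (sumℤ-allSubsets-suc k _) (cong (λ t → t + signed-sum (c ∘ (outside ∷_))) (begin
  sumℤ (map (λ S → sign (inside ∷ S) * + c (inside ∷ S)) (allSubsets k))
    ≡⟨ cong sumℤ (map-cong (λ S → sign-inside∷ S (+ c (inside ∷ S))) (allSubsets k)) ⟩
  sumℤ (map (λ S → - (sign S * + c (inside ∷ S))) (allSubsets k))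
    ≡⟨ sumℤ-map-neg (λ S → sign S * + c (inside ∷ S)) (allSubsets k) ⟩
  - signed-sum (c ∘ (inside ∷_)) ∎))
  where
  open ≡-Reasoning
  sign-inside∷ : ∀ (S : Subset k) i → sign (inside ∷ S) * i ≡ - (sign S * i)
  sign-inside∷ S i = trans (cong (_* i) (ℤP.-1*i≡-i (sign S))) (sym (ℤP.neg-distribˡ-* (sign S) i))

+-difference : ∀ {a b c} → c ≡ a ℕ.+ b → + b ≡ - + a + + c
+-difference {a} {b} refl = trans (sym (\\-leftDividesʳ (+ a) (+ b))) (cong (λ t → - + a + t) (sym (ℤP.pos-+ a b)))

inclusion–exclusion :
  ∀ {X : Set} (xs : List X) k
    {A : Pred X 0ℓ} (A? : Decidable A) {G : Fin k → Pred X 0ℓ} (G? : ∀ i → Decidable (G i))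
    {H : Subset k → Pred X 0ℓ} (H? : ∀ S → Decidable (H S)) {B : Pred X 0ℓ} (B? : Decidable B) →
  (∀ S → H S ≐ (A ∩ λ x → ∀ i → i ∈ S → G i x)) →
  B ≐ (A ∩ λ x → ∀ i → ¬ G i x) →
  + countIn B? xs ≡ signed-sum (λ S → countIn (H? S) xs)
inclusion–exclusion xs zero {A} A? {G} G? {H} H? {B} B? H≐ B≐ = begin
  + countIn B? xs      ≡⟨ cong +_ (countIn-≐ B? (H? []) B≐H[] xs) ⟩
  + countIn (H? []) xs ≡⟨ sym (trans (ℤP.+-identityʳ _) (ℤP.*-identityˡ _)) ⟩
  sign [] * + countIn (H? []) xs + + 0 ∎
  where
  open ≡-Reasoning
  B≐H[] : B ≐ H []
  B≐H[] = (λ b → proj₂ (H≐ []) (proj₁ (proj₁ B≐ b) , λ ()))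
        , (λ h → proj₂ B≐ (proj₁ (proj₁ (H≐ []) h) , λ ()))
inclusion–exclusion xs (suc k) {A} A? {G} G? {H} H? {B} B? H≐ B≐ = begin
  + countIn B? xs                                       ≡⟨ +-difference split ⟩
  - + countIn B₁? xs + + countIn (A? ∩? NoneAfter?) xs ≡⟨ cong₂ (λ a b → - a + b) IH₁ IH₂ ⟩
  - signed-sum (c ∘ (inside ∷_)) + signed-sum (c ∘ (outside ∷_)) ≡⟨ sym (signed-sum-suc c) ⟩
  signed-sum c                                          ∎
  where
  open ≡-Reasoning
  c : Subset (suc k) → ℕ
  c S = countIn (H? S) xs
  NoneAfter : Pred _ 0ℓ
  NoneAfter x = ∀ i → ¬ G (suc i) x
  NoneAfter? : Decidable NoneAfter
  NoneAfter? x = all? (λ i → ¬? (G? (suc i) x))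
  B₁? : Decidable ((A ∩ G zero) ∩ NoneAfter)
  B₁? = (A? ∩? G? zero) ∩? NoneAfter?
  IH₁ : + countIn B₁? xs ≡ signed-sum (c ∘ (inside ∷_))
  IH₁ = inclusion–exclusion xs k (A? ∩? G? zero) (G? ∘ suc) (H? ∘ (inside ∷_)) B₁?
          (λ S → (λ h → let (a , g) = proj₁ (H≐ (inside ∷ S)) h in
                          (a , g zero here) , λ i i∈S → g (suc i) (there i∈S))
               , (λ ((a , g₀) , g) → proj₂ (H≐ (inside ∷ S))
                          (a , λ { zero _ → g₀ ; (suc i) (there i∈S) → g i i∈S })))
          (id , id)
  IH₂ : + countIn (A? ∩? NoneAfter?) xs ≡ signed-sum (c ∘ (outside ∷_))
  IH₂ = inclusion–exclusion xs k A? (G? ∘ suc) (H? ∘ (outside ∷_)) (A? ∩? NoneAfter?)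
          (λ S → (λ h → let (a , g) = proj₁ (H≐ (outside ∷ S)) h in
                          a , λ i i∈S → g (suc i) (there i∈S))
               , (λ (a , g) → proj₂ (H≐ (outside ∷ S))
                          (a , λ { zero () ; (suc i) (there i∈S) → g i i∈S })))
          (id , id)
  split : countIn (A? ∩? NoneAfter?) xs ≡ countIn B₁? xs ℕ.+ countIn B? xs
  split = trans (countIn-split (A? ∩? NoneAfter?) (G? zero) xs)
    (cong₂ ℕ._+_
      (countIn-≐ _ B₁? ((λ ((a , n) , g₀) → (a , g₀) , n) , (λ ((a , g₀) , n) → (a , n) , g₀)) xs)
      (countIn-≐ _ B? ((λ ((a , n) , ¬g₀) → proj₂ B≐ (a , λ { zero → ¬g₀ ; (suc i) → n i }))
                     , (λ b → let (a , n) = proj₁ B≐ b in (a , n ∘ suc) , n zero)) xs))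

sendToBack : ∀ {A : Set} {l} → Subset (pred l) → Vec A l → Vec A l
sendToBack {l = zero}        []          []      = []
sendToBack {l = suc zero}    []          (x ∷ []) = x ∷ []
sendToBack {l = suc (suc k)} (inside ∷ S)  (x ∷ v) = sendToBack S v ∷ʳ x
sendToBack {l = suc (suc k)} (outside ∷ S) (x ∷ v) = x ∷ sendToBack S v

filter-map : ∀ {X Y : Set} {P : Pred Y 0ℓ} (P? : Decidable P) (g : X → Y) (xs : List X) →
             filter P? (map g xs) ≡ map g (filter (P? ∘ g) xs)
filter-map P? g []       = refl
filter-map P? g (x ∷ xs) with P? (g x)
... | yes _ = cong (g x ∷_) (filter-map P? g xs)
... | no _  = filter-map P? g xs

allFin-suc : ∀ k → allFin (suc k) ≡ zero ∷ map suc (allFin k)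
allFin-suc k = cong (zero ∷_) (sym (map-tabulate id suc))

elems-suc : ∀ {k} s (S : Subset k) → filter (_∈? (s ∷ S)) (map suc (allFin k)) ≡ map suc (elems S)
elems-suc {k} s S = trans (filter-map (_∈? (s ∷ S)) suc (allFin k))
                          (cong (map suc) (filter-≐ _ (_∈? S) (drop-there , there) (allFin k)))

elems-inside∷ : ∀ {k} (S : Subset k) → elems (inside ∷ S) ≡ zero ∷ map suc (elems S)
elems-inside∷ {k} S = trans (cong (filter (_∈? (inside ∷ S))) (allFin-suc k)) (cong (zero ∷_) (elems-suc inside S))

elems-outside∷ : ∀ {k} (S : Subset k) → elems (outside ∷ S) ≡ map suc (elems S)
elems-outside∷ {k} S = trans (cong (filter (_∈? (outside ∷ S))) (allFin-suc k)) (elems-suc outside S)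

f-suc : ∀ {A : Set} {k} (i : Fin k) x (u : Vec A (suc k)) → f (suc i) (x ∷ u) ≡ x ∷ f i u
f-suc i x (y ∷ u) = refl

foldr-f-map-suc : ∀ {A : Set} {k} x (v : Vec A (suc k)) (is : List (Fin k)) →
                  foldr f (x ∷ v) (map suc is) ≡ x ∷ foldr f v is
foldr-f-map-suc x v []       = refl
foldr-f-map-suc x v (i ∷ is) = trans (cong (f (suc i)) (foldr-f-map-suc x v is)) (f-suc i x (foldr f v is))

fS≡sendToBack : ∀ {A : Set} {l} (S : Subset (pred l)) (w : Vec A l) → fS S w ≡ sendToBack S w
fS≡sendToBack {l = zero}        []            []       = refl
fS≡sendToBack {l = suc zero}    []            (x ∷ []) = refl
fS≡sendToBack {l = suc (suc k)} (inside ∷ S)  (x ∷ v)  = begin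
  foldr f (x ∷ v) (elems (inside ∷ S))    ≡⟨ cong (foldr f (x ∷ v)) (elems-inside∷ S) ⟩
  f zero (foldr f (x ∷ v) (map suc (elems S))) ≡⟨ cong (f zero) (foldr-f-map-suc x v (elems S)) ⟩
  fS S v ∷ʳ x                              ≡⟨ cong (_∷ʳ x) (fS≡sendToBack S v) ⟩
  sendToBack S v ∷ʳ x                      ∎
  where open ≡-Reasoning
fS≡sendToBack {l = suc (suc k)} (outside ∷ S) (x ∷ v)  = begin
  foldr f (x ∷ v) (elems (outside ∷ S))   ≡⟨ cong (foldr f (x ∷ v)) (elems-outside∷ S) ⟩
  foldr f (x ∷ v) (map suc (elems S))     ≡⟨ foldr-f-map-suc x v (elems S) ⟩
  x ∷ fS S v                              ≡⟨ cong (x ∷_) (fS≡sendToBack S v) ⟩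
  x ∷ sendToBack S v                      ∎
  where open ≡-Reasoning

sendToBack-⊥ : ∀ {A : Set} {l} (w : Vec A l) → sendToBack ⊥ w ≡ w
sendToBack-⊥ {l = zero}        []       = refl
sendToBack-⊥ {l = suc zero}    (x ∷ []) = refl
sendToBack-⊥ {l = suc (suc k)} (x ∷ v)  = cong (x ∷_) (sendToBack-⊥ v)

f≡sendToBack-⁅⁆ : ∀ {A : Set} {l} (i : Fin (pred l)) (w : Vec A l) → f i w ≡ sendToBack ⁅ i ⁆ w
f≡sendToBack-⁅⁆ {l = suc (suc k)} zero    (x ∷ v) = cong (_∷ʳ x) (sym (sendToBack-⊥ v))
f≡sendToBack-⁅⁆ {l = suc (suc k)} (suc i) (x ∷ v) = trans (f-suc i x v) (cong (x ∷_) (f≡sendToBack-⁅⁆ i v))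

inject-pred : ∀ {l} → Fin (pred l) → Fin l
inject-pred {suc k} = inject₁

inject-pred-<-suc : ∀ {l} (i : Fin (pred l)) → ∃ λ (p : Fin l) → inject-pred {l} i F.< p
inject-pred-<-suc {suc k} i = suc i , s≤s (ℕP.≤-reflexive (FP.toℕ-inject₁ i))

inject-pred⊎last : ∀ {l} (p : Fin l) → (∃ λ i → inject-pred {l} i ≡ p) ⊎ (∀ (q : Fin l) → q F.≤ p)
inject-pred⊎last {suc k} p with k ℕ.≟ toℕ p
... | yes k≡p = inj₂ λ q → subst (toℕ q ℕ.≤_) k≡p (ℕP.≤-pred (FP.toℕ<n q))
... | no  k≢p = inj₁ (lower₁ p k≢p , FP.inject₁-lower₁ p k≢p)

AllPairs-lookup⁻ : ∀ {A : Set} {R : Rel A 0ℓ} {l} (v : Vec A l) →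
                   (∀ i j → i F.< j → R (lookup v i) (lookup v j)) → AllPairs R v
AllPairs-lookup⁻ []      _ = []
AllPairs-lookup⁻ (x ∷ v) h = lookup⁻ (λ k → h zero (suc k) (s≤s z≤n))
                           ∷ AllPairs-lookup⁻ v (λ i j i<j → h (suc i) (suc j) (s≤s i<j))

module _ {A : Set} {P : Pred A 0ℓ} where

  All-∷ʳ⁺ : ∀ {l} {u : Vec A l} {x} → All P u → P x → All P (u ∷ʳ x)
  All-∷ʳ⁺ []         px = px ∷ []
  All-∷ʳ⁺ (py ∷ pu) px = py ∷ All-∷ʳ⁺ pu px

  All-∷ʳ⁻ : ∀ {l} (u : Vec A l) {x} → All P (u ∷ʳ x) → All P u × P x
  All-∷ʳ⁻ []      (px ∷ [])  = [] , px
  All-∷ʳ⁻ (y ∷ u) (py ∷ pux) = let (pu , px) = All-∷ʳ⁻ u pux in py ∷ pu , px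

  All-sendToBack : ∀ {l} (S : Subset (pred l)) (v : Vec A l) → All P (sendToBack S v) ⇔ All P v
  All-sendToBack {zero}        []            []       = mk⇔ id id
  All-sendToBack {suc zero}    []            (x ∷ []) = mk⇔ id id
  All-sendToBack {suc (suc k)} (inside ∷ S)  (x ∷ v)  = mk⇔
    (λ p → let (pv , px) = All-∷ʳ⁻ (sendToBack S v) p in px ∷ to (All-sendToBack S v) pv)
    (λ { (px ∷ pv) → All-∷ʳ⁺ (from (All-sendToBack S v) pv) px })
  All-sendToBack {suc (suc k)} (outside ∷ S) (x ∷ v)  = mk⇔
    (λ { (px ∷ pv) → px ∷ to (All-sendToBack S v) pv })
    (λ { (px ∷ pv) → px ∷ from (All-sendToBack S v) pv })

module LastSatisfying {A : Set} {Q : Pred A 0ℓ} (Q? : Decidable Q) where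

  IsLast : ∀ {l} → Vec A l → Fin l → Set
  IsLast σ j = Q (lookup σ j) × (∀ k → Q (lookup σ k) → k F.≤ j)

  last-exists : ∀ {l} (σ : Vec A l) {j₀} → Q (lookup σ j₀) → ∃ (IsLast σ)
  last-exists (x ∷ u) {j₀} qj₀ with any? (λ k → Q? (lookup u k)) | j₀
  ... | yes (k , qk) | _ = let (j , qj , last) = last-exists u qk in
                           suc j , qj , λ { zero _ → z≤n ; (suc k) qk → s≤s (last k qk) }
  ... | no ∄k | suc k₀ = ⊥-elim (∄k (k₀ , qj₀))
  ... | no ∄k | zero   = zero , qj₀ , λ { zero _ → z≤n ; (suc k) qk → ⊥-elim (∄k (k , qk)) }

  module Bounded (L : A → ℕ) (b : ℕ) where

    LastBounded : ∀ {l} → Vec A l → Set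
    LastBounded []      = ⊤
    LastBounded (x ∷ u) = LastBounded u × (All (∁ Q) u → Q x → L x ≤ b)

    lastBounded⇔ : ∀ {l} (σ : Vec A l) → LastBounded σ ⇔ (∀ j → IsLast σ j → L (lookup σ j) ≤ b)
    lastBounded⇔ σ = mk⇔ (bound σ) (lastBounded σ)
      where
      bound : ∀ {l} (σ : Vec A l) → LastBounded σ → ∀ j → IsLast σ j → L (lookup σ j) ≤ b
      bound (x ∷ u) (_ , hx)  zero    (qx , last) = hx (lookup⁻ λ k qk → ℕP.<⇒≱ (s≤s z≤n) (last (suc k) qk)) qx
      bound (x ∷ u) (lbu , _) (suc j) (qj , last) = bound u lbu j (qj , λ k qk → ℕP.≤-pred (last (suc k) qk))
      lastBounded : ∀ {l} (σ : Vec A l) → (∀ j → IsLast σ j → L (lookup σ j) ≤ b) → LastBounded σ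
      lastBounded []      _ = tt
      lastBounded (x ∷ u) h =
          lastBounded u (λ j (qj , last) → h (suc j) (qj , λ { zero _ → z≤n ; (suc k) qk → s≤s (last k qk) }))
        , λ none qx → h zero (qx , λ { zero _ → z≤n ; (suc k) qk → ⊥-elim (lookup⁺ none k qk) })

    LastBounded-∷ʳ : ∀ {l} (u : Vec A l) x →
                     LastBounded (u ∷ʳ x) ⇔ ((Q x → L x ≤ b) × (¬ Q x → LastBounded u))
    LastBounded-∷ʳ []      x = mk⇔ (λ (_ , hx) → hx [] , λ _ → tt) (λ (hx , _) → tt , λ _ → hx)
    LastBounded-∷ʳ (y ∷ u) x = mk⇔
      (λ (lbux , hy) → let (hx , lbu) = to (LastBounded-∷ʳ u x) lbux in
         hx , λ ¬qx → lbu ¬qx , λ none qy → hy (All-∷ʳ⁺ none ¬qx) qy)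
      (λ (hx , lbyu) → from (LastBounded-∷ʳ u x) (hx , proj₁ ∘ lbyu)
         , λ noneux qy → let (none , ¬qx) = All-∷ʳ⁻ u noneux in proj₂ (lbyu ¬qx) none qy)

    All-bounded⇒LastBounded : ∀ {l} {u : Vec A l} → All (λ x → L x ≤ b) u → LastBounded u
    All-bounded⇒LastBounded []         = tt
    All-bounded⇒LastBounded (lx ∷ lu) = All-bounded⇒LastBounded lu , λ _ _ → lx

    BoundedOn : ∀ {l} → Subset (pred l) → Vec A l → Set
    BoundedOn S w = ∀ s → s ∈ S → Q (lookup w (inject-pred s)) → L (lookup w (inject-pred s)) ≤ b

    -- As L decreases along w, the last Q-entry of sendToBack S w is the earliest Q-entry of w
    -- at a position in S, and its L-value bounds that of every later Q-entry of w.
    LastBounded-sendToBack : ∀ {l} (S : Subset (pred l)) {w : Vec A l} → AllPairs (λ x y → L y < L x) w →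
                             LastBounded (sendToBack S w) ⇔ (LastBounded w × BoundedOn S w)
    LastBounded-sendToBack {zero}     [] {[]}     _ = mk⇔ (_, λ ()) proj₁
    LastBounded-sendToBack {suc zero} [] {x ∷ []} _ = mk⇔ (_, λ ()) proj₁
    LastBounded-sendToBack {suc (suc k)} (inside ∷ S) {x ∷ v} (x>v ∷ v↓) = mk⇔ forward backward
      where
      forward : LastBounded (sendToBack S v ∷ʳ x) → LastBounded (x ∷ v) × BoundedOn (inside ∷ S) (x ∷ v)
      forward h with to (LastBounded-∷ʳ (sendToBack S v) x) h | Q? x
      ... | hx , _ | yes qx =
        let v≤b = All.map (λ lt → ℕP.≤-trans (ℕP.<⇒≤ lt) (hx qx)) x>v in
        (All-bounded⇒LastBounded v≤b , λ _ _ → hx qx)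
        , λ { zero _ _ → hx qx ; (suc s) _ _ → lookup⁺ v≤b (inject-pred s) }
      ... | _ , lbv | no ¬qx =
        let (lbv , bv) = to (LastBounded-sendToBack S v↓) (lbv ¬qx) in
        (lbv , λ _ qx → ⊥-elim (¬qx qx))
        , λ { zero _ qx → ⊥-elim (¬qx qx) ; (suc s) (there s∈S) → bv s s∈S }
      backward : LastBounded (x ∷ v) × BoundedOn (inside ∷ S) (x ∷ v) → LastBounded (sendToBack S v ∷ʳ x)
      backward ((lbv , _) , bxv) = from (LastBounded-∷ʳ (sendToBack S v) x)
        (bxv zero here , λ _ → from (LastBounded-sendToBack S v↓) (lbv , λ s s∈S → bxv (suc s) (there s∈S)))
    LastBounded-sendToBack {suc (suc k)} (outside ∷ S) {x ∷ v} (_ ∷ v↓) = mk⇔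
      (λ (lbs , hx) → let (lbv , bv) = to (LastBounded-sendToBack S v↓) lbs in
         (lbv , hx ∘ from (All-sendToBack S v)) , λ { (suc s) (there s∈S) → bv s s∈S })
      (λ ((lbv , hx) , bxv) → from (LastBounded-sendToBack S v↓) (lbv , λ s s∈S → bxv (suc s) (there s∈S))
                            , hx ∘ to (All-sendToBack S v))

∃-label-zero : ∀ {n} (ϕ : Vec (Fin n) n) → (∀ k → ∃ λ x → lookup ϕ x ≡ k) → Fin n →
               ∃ λ x → toℕ (lookup ϕ x) ≡ 0
∃-label-zero {ℕ.suc _} ϕ onto _ = let (x , ϕx≡0) = onto zero in x , cong toℕ ϕx≡0

module _ {n} (P : FinPoset n) where
  open FinPoset P
  open IsDecPartialOrder isDecPartialOrder using (isPartialOrder) renaming (refl to ≼-refl; trans to ≼-trans)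

  minimal-below : ∀ x → ∃ λ u → Minimal u × u ≼ x
  minimal-below x = go x (po-wellFounded isPartialOrder x)
    where
    go : ∀ x → Acc _≺_ x → ∃ λ u → Minimal u × u ≼ x
    go x (acc below) with any? (_≺? x)
    ... | yes (y , y≺x) = let (u , min-u , u≼y) = go y (below y≺x) in u , min-u , ≼-trans u≼y (proj₁ y≺x)
    ... | no  ∄y≺x      =
      x , (λ y y≼x → decidable-stable (y FP.≟ x) (λ y≢x → ∄y≺x (y , y≼x , y≢x))) , ≼-refl

module ZigzagLabelings {n m} (P : FinPoset n) (z : Fin m → Fin n)
  (z-minimal : ∀ a → FinPoset.Minimal P (z a))
  (z-onto : ∀ x → FinPoset.Minimal P x → ∃ λ a → z a ≡ x)
  (w : Vec (Fin m) m) (w-onto : ∀ a → ∃ λ p → lookup w p ≡ a) where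

  open FinPoset P
  open Labelings P z

  zw : Fin m → Fin n
  zw p = z (lookup w p)

  label : Vec (Fin n) n → Fin n → ℕ
  label ϕ x = toℕ (lookup ϕ x)

  position-of-minimal : ∀ x → Minimal x → ∃ λ p → zw p ≡ x
  position-of-minimal x min-x =
    let (a , za≡x) = z-onto x min-x ; (p , wp≡a) = w-onto a in p , trans (cong z wp≡a) za≡x

  θ-exists : ∀ y → ∃ (IsTheta w y)
  θ-exists y =
    let (u , min-u , u≼y) = minimal-below P y ; (p , zwp≡u) = position-of-minimal u min-u in
    LastSatisfying.last-exists (λ a → z a ≤? y) w (subst (_≼ y) (sym zwp≡u) u≼y)

  HasType⇒antitone : ∀ ϕ → HasType w ϕ → ∀ {p j} → p F.≤ j → label ϕ (zw j) ≤ label ϕ (zw p)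
  HasType⇒antitone ϕ ht {p} {j} p≤j with p FP.≟ j
  ... | yes refl = ℕP.≤-refl
  ... | no  p≢j  = ℕP.<⇒≤ (ht p j (FP.≤∧≢⇒< p≤j p≢j))

  MinOnUpset : Vec (Fin n) n → Fin n → Set
  MinOnUpset ϕ x = ∀ y → x ≼ y → lookup ϕ x F.≤ lookup ϕ y

  MinOnUpset? : ∀ ϕ x → Dec (MinOnUpset ϕ x)
  MinOnUpset? ϕ x = all? λ y → (x ≤? y) →-dec (lookup ϕ x F.≤? lookup ϕ y)

  ¬MinOnUpset⇔descent : ∀ ϕ x → (¬ MinOnUpset ϕ x) ⇔ (∃ λ y → x ≺ y × lookup ϕ y F.< lookup ϕ x)
  ¬MinOnUpset⇔descent ϕ x = mk⇔ descent (λ (y , (x≼y , _) , ϕy<ϕx) min → ℕP.<⇒≱ ϕy<ϕx (min y x≼y))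
    where
    descent : ¬ MinOnUpset ϕ x → ∃ λ y → x ≺ y × lookup ϕ y F.< lookup ϕ x
    descent ¬min with ¬∀⟶∃¬ n _ (λ y → (x ≤? y) →-dec (lookup ϕ x F.≤? lookup ϕ y)) ¬min
    ... | y , ¬bound with x ≤? y
    ...   | no  x⋠y = ⊥-elim (¬bound (⊥-elim ∘ x⋠y))
    ...   | yes x≼y =
      y , (x≼y , λ { refl → ¬bound (λ _ → ℕP.≤-refl) }) , ℕP.≰⇒> (¬bound ∘ λ ϕx≤ϕy _ → ϕx≤ϕy)

  ThetaBounded : Vec (Fin m) m → Vec (Fin n) n → Set
  ThetaBounded σ ϕ = ∀ y j → IsTheta σ y j → lookup ϕ (z (lookup σ j)) F.≤ lookup ϕ y

  MinOnUpsetOn : Subset (pred m) → Vec (Fin n) n → Set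
  MinOnUpsetOn S ϕ = ∀ s → s ∈ S → MinOnUpset ϕ (zw (inject-pred s))

  ThetaBounded-sendToBack : ∀ S ϕ → HasType w ϕ →
                            ThetaBounded (sendToBack S w) ϕ ⇔ (ThetaBounded w ϕ × MinOnUpsetOn S ϕ)
  ThetaBounded-sendToBack S ϕ ht = mk⇔
    (λ tb → (λ y → to (Below.lastBounded⇔ y w) (proj₁ (split tb y)))
          , (λ s s∈S y → proj₂ (split tb y) s s∈S))
    (λ (tb , min) y → to (Below.lastBounded⇔ y (sendToBack S w))
      (from (sendToBack⇔ y) (from (Below.lastBounded⇔ y w) (tb y) , λ s s∈S → min s s∈S y)))
    where
    module Below y = LastSatisfying.Bounded (λ a → z a ≤? y) (label ϕ ∘ z) (label ϕ y)
    sendToBack⇔ : ∀ y → Below.LastBounded y (sendToBack S w) ⇔ (Below.LastBounded y w × Below.BoundedOn y S w)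
    sendToBack⇔ y = Below.LastBounded-sendToBack y S (AllPairs-lookup⁻ w ht)
    split : ThetaBounded (sendToBack S w) ϕ → ∀ y → Below.LastBounded y w × Below.BoundedOn y S w
    split tb y = to (sendToBack⇔ y) (from (Below.lastBounded⇔ y (sendToBack S w)) (tb y))

  T-sendToBack : ∀ S ϕ → T w (sendToBack S w) ϕ ⇔ (T w w ϕ × MinOnUpsetOn S ϕ)
  T-sendToBack S ϕ = mk⇔
    (λ (bij , ht , tb) → let (tbw , min) = to (ThetaBounded-sendToBack S ϕ ht) tb in (bij , ht , tbw) , min)
    (λ ((bij , ht , tbw) , min) → bij , ht , from (ThetaBounded-sendToBack S ϕ ht) (tbw , min))

  T-fS : ∀ S ϕ → T w (fS S w) ϕ ⇔ (T w w ϕ × MinOnUpsetOn S ϕ)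
  T-fS S ϕ rewrite fS≡sendToBack S w = T-sendToBack S ϕ

  T-f : ∀ i ϕ → T w (f i w) ϕ ⇔ (T w w ϕ × MinOnUpset ϕ (zw (inject-pred i)))
  T-f i ϕ rewrite f≡sendToBack-⁅⁆ i w = mk⇔
    (λ t → let (tw , min) = to (T-sendToBack ⁅ i ⁆ ϕ) t in tw , min i (x∈⁅x⁆ i))
    (λ (tw , min) → from (T-sendToBack ⁅ i ⁆ ϕ)
      (tw , λ s s∈⁅i⁆ →
        subst (MinOnUpset ϕ ∘ zw ∘ inject-pred) (sym (x∈⁅y⁆⇒x≡y i s∈⁅i⁆)) min))

  ZigzagAtMinimal : Vec (Fin n) n → Set
  ZigzagAtMinimal ϕ = ∀ x → Minimal x → label ϕ x ≢ 0 → ∃ λ y → x ≺ y × lookup ϕ y F.< lookup ϕ x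

  ZigzagAtNonMinimal : Vec (Fin n) n → Set
  ZigzagAtNonMinimal ϕ = ∀ x → ¬ Minimal x → ∃ λ y → Minimal y × y ≺ x × lookup ϕ y F.< lookup ϕ x

  ZigzagAtNonMinimal⇔ThetaBounded : ∀ ϕ → IsBijection ϕ → HasType w ϕ →
                                    ZigzagAtNonMinimal ϕ ⇔ ThetaBounded w ϕ
  ZigzagAtNonMinimal⇔ThetaBounded ϕ (ϕ-injective , _) ht = mk⇔ bounded ascent
    where
    bounded : ZigzagAtNonMinimal ϕ → ThetaBounded w ϕ
    bounded zz y j (zwj≼y , last) with Minimal? y
    ... | yes min-y = ℕP.≤-reflexive (cong (label ϕ) (min-y _ zwj≼y))
    ... | no ¬min-y =
      let (y' , min-y' , (y'≼y , _) , ϕy'<ϕy) = zz y ¬min-y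
          (p , zwp≡y') = position-of-minimal y' min-y'
          p≤j = last p (subst (_≼ y) (sym zwp≡y') y'≼y)
      in ℕP.≤-trans (HasType⇒antitone ϕ ht p≤j)
                    (ℕP.<⇒≤ (subst (λ x → label ϕ x < label ϕ y) (sym zwp≡y') ϕy'<ϕy))
    ascent : ThetaBounded w ϕ → ZigzagAtNonMinimal ϕ
    ascent tb x ¬min-x =
      let (j , θ) = θ-exists x
          zwj≢x = λ (zwj≡x : zw j ≡ x) → ¬min-x (subst Minimal zwj≡x (z-minimal _))
      in zw j , z-minimal _ , (proj₁ θ , zwj≢x) , FP.≤∧≢⇒< (tb x j θ) (zwj≢x ∘ ϕ-injective _ _)

  last-label-zero : ∀ ϕ {p} → T w w ϕ → (∀ q → q F.≤ p) → label ϕ (zw p) ≡ 0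
  last-label-zero ϕ {p} ((_ , ϕ-onto) , ht , tb) p-last =
    let (u , ϕu≡0) = ∃-label-zero ϕ ϕ-onto (zw p)
        (j , θ) = θ-exists u
    in ℕP.n≤0⇒n≡0 (ℕP.≤-trans (HasType⇒antitone ϕ ht (p-last j))
                              (subst (label ϕ (zw j) ≤_) ϕu≡0 (tb u j θ)))

  ZigzagAtMinimal⇔ : ∀ ϕ → T w w ϕ → ZigzagAtMinimal ϕ ⇔ (∀ i → ¬ MinOnUpset ϕ (zw (inject-pred i)))
  ZigzagAtMinimal⇔ ϕ t@(_ , ht , _) = mk⇔ not-min zigzag
    where
    not-min : ZigzagAtMinimal ϕ → ∀ i → ¬ MinOnUpset ϕ (zw (inject-pred i))
    not-min zz i = from (¬MinOnUpset⇔descent ϕ _) (zz _ (z-minimal _) label≢0)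
      where
      label≢0 : label ϕ (zw (inject-pred i)) ≢ 0
      label≢0 eq = let (p , i<p) = inject-pred-<-suc i in ℕP.n≮0 (subst (label ϕ (zw p) <_) eq (ht _ p i<p))
    zigzag : (∀ i → ¬ MinOnUpset ϕ (zw (inject-pred i))) → ZigzagAtMinimal ϕ
    zigzag ¬min x min-x label≢0 with position-of-minimal x min-x
    ... | p , refl with inject-pred⊎last p
    ...   | inj₁ (i , refl) = to (¬MinOnUpset⇔descent ϕ _) (¬min i)
    ...   | inj₂ p-last     = ⊥-elim (label≢0 (last-label-zero ϕ t p-last))

  zigzag⇔ : ∀ ϕ → ZigzagOfType w ϕ ⇔ (T w w ϕ × ∀ i → ¬ MinOnUpset ϕ (zw (inject-pred i)))
  zigzag⇔ ϕ = mk⇔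
    (λ ((bij , zz₁ , zz₂) , ht) →
       let t = bij , ht , to (ZigzagAtNonMinimal⇔ThetaBounded ϕ bij ht) zz₂ in t , to (ZigzagAtMinimal⇔ ϕ t) zz₁)
    (λ (t , ¬min) → let (bij , ht , tb) = t in
       (bij , from (ZigzagAtMinimal⇔ ϕ t) ¬min , from (ZigzagAtNonMinimal⇔ThetaBounded ϕ bij ht) tb) , ht)

  zigzag⇔T∖⋃T : ∀ ϕ → ZigzagOfType w ϕ ⇔ (T w w ϕ × ∀ i → ¬ T w (f i w) ϕ)
  zigzag⇔T∖⋃T ϕ = mk⇔
    (λ zz → let (t , ¬min) = to (zigzag⇔ ϕ) zz in t , λ i → ¬min i ∘ proj₂ ∘ to (T-f i ϕ))
    (λ (t , ¬Tf) → from (zigzag⇔ ϕ) (t , λ i min → ¬Tf i (from (T-f i ϕ) (t , min))))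

  zigzag-count : + count (ZigzagOfType? w) ≡ signed-sum (λ S → count (T? w (fS S w)))
  zigzag-count = inclusion–exclusion (allVecs n n) (pred m) (T? w w) (λ i ϕ → MinOnUpset? ϕ (zw (inject-pred i)))
                   (λ S → T? w (fS S w)) (ZigzagOfType? w) (λ S → ⇔⇒≐ (T-fS S)) (⇔⇒≐ zigzag⇔)

word-onto : ∀ {m} (π : Permutation′ m) a → ∃ λ p → lookup (word π) p ≡ a
word-onto π a = π ⟨$⟩ˡ a , trans (lookup∘tabulate (π ⟨$⟩ʳ_) (π ⟨$⟩ˡ a)) (inverseʳ π)

lemma4p16 : ∀ {n m} (P : FinPoset n) (z : Fin m → Fin n)
  → (∀ i → FinPoset.Minimal P (z i))
  → Injective _≡_ _≡_ z
  → (∀ x → FinPoset.Minimal P x → ∃ λ i → z i ≡ x)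
  → (π : Permutation′ m)
  → let open Labelings P z in
    (∀ (ϕ : Vec (Fin n) n) →
       ZigzagOfType (word π) ϕ
         ⇔ (T (word π) (word π) ϕ × (∀ (i : Fin (pred m)) → ¬ T (word π) (f i (word π)) ϕ)))
    × (+ count (ZigzagOfType? (word π))
         ≡ sumℤ (map (λ S → sign S * + count (T? (word π) (fS S (word π)))) (allSubsets (pred m))))
lemma4p16 P z z-minimal _ z-onto π = zigzag⇔T∖⋃T , zigzag-count
  where open ZigzagLabelings P z z-minimal z-onto (word π) (word-onto π)
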